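{- The language $Q_I$ of ins-robust primitive words over $V$ is not regular.
   Context: $V$ is a finite alphabet with at least two distinct letters; $V^*$ is the set of all finite words over $V$. A nonempty word $w$ is primitive if it is not of the form $v^n$ for a word $v$ and an integer $n \ge 2$. For a word $w$ of length $n$, $w[1..i]$ denotes its prefix of length $i$ and $w[i+1..n]$ its suffix of length $n-i$. A primitive word $w$ of length $n$ is ins-robust if for every $i \in \{0,\ldots,n\}$ and every $a \in V$ the word $w[1..i]\,a\,w[i+1..n]$ is primitive; $Q_I$ is the set of ins-robust primitive words over $V$. -}

module Defs where

open import Data.Nat using (ℕ; zero; suc; _≤_)
open import Data.Fin using (Fin)
open import Data.Bool using (Bool; T)
open import Data.List using (List; []; _∷_; _++_; take; drop; length; foldl)
open import Data.Product using (Σ; _×_; ∃-syntax)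
open import Relation.Binary.PropositionalEquality using (_≡_)
open import Relation.Nullary using (¬_)
open import Function.Bundles using (_⇔_)

Word : ℕ → Set
Word k = List (Fin k)

_^^_ : ∀ {A : Set} → List A → ℕ → List A
v ^^ zero = []
v ^^ suc n = v ++ (v ^^ n)

Primitive : ∀ {k} → Word k → Set
Primitive w = ¬ (w ≡ []) × ¬ (∃[ v ] ∃[ n ] (2 ≤ n × w ≡ v ^^ n))

insertAt : ∀ {A : Set} → ℕ → A → List A → List A
insertAt i a w = take i w ++ (a ∷ drop i w)

QI : ∀ k → Word k → Set
QI k w = Primitive w × (∀ (i : ℕ) → i ≤ length w → ∀ (a : Fin k) → Primitive (insertAt i a w))

record DFA (k : ℕ) : Set where
  field
    nStates : ℕ
    δ       : Fin nStates → Fin k → Fin nStates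
    q₀      : Fin nStates
    final   : Fin nStates → Bool

Accepts : ∀ {k} → DFA k → Word k → Set
Accepts M w = T (final (foldl δ q₀ w))
  where open DFA M

Regular : ∀ {k} → (Word k → Set) → Set
Regular {k} L = Σ (DFA k) λ M → ∀ w → L w ⇔ Accepts M w

-- Counting two distinct letters a and b: a proper power v ^^ n has both counts divisible by n,
-- so coprime counts force primitivity. Inserting a letter raises at most one of the counts (x, y)
-- by one, so w is ins-robust once x, x + 1 are coprime to y and x to y + 1, which holds for x odd
-- and y = 2x + 1. A DFA reaches the same state on a ^ P and a ^ Q for some P < Q, and there is a
-- suffix s making a ^ P s b a proper power (so a ^ P s is not ins-robust) while the counts of
-- a ^ Q s are x odd and 2x + 1.

module Submission where

open import Defs
open import Data.Nat using (ℕ; zero; suc; _+_; _*_; _≤_; _<_; z≤n; s≤s)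
open import Data.Nat.Properties using (≤-refl; +-commutativeSemigroup; +-comm; +-suc; +-identityʳ; *-comm; +-cancelʳ-≡; m≤n⇒∃[o]m+o≡n; n<1+n)
open import Data.Nat.Divisibility using (_∣_; divides)
open import Data.Nat.Coprimality using (Coprime; coprime-+; 1-coprimeTo; 0-coprimeTo-m⇒m≡1)
  renaming (sym to coprime-sym)
open import Data.Nat.Tactic.RingSolver using (solve-∀)
open import Algebra.Properties.CommutativeSemigroup +-commutativeSemigroup using (x∙yz≈y∙xz)
open import Data.Fin using (Fin; toℕ) renaming (zero to fzero; suc to fsuc)
open import Data.Fin.Properties using (_≟_; pigeonhole)
open import Data.List using (List; []; _++_; [_]; length; filter; replicate; foldl; take; drop)
open import Data.List.Properties using (length-++; filter-++; filter-accept; filter-reject; foldl-++; ++-assoc; ++-identityʳ; take-all; drop-all; take++drop≡id)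
open import Data.Product using (∃-syntax; _×_; _,_; proj₂)
open import Data.Bool using (T)
open import Relation.Nullary using (¬_; yes; no)
open import Relation.Binary.PropositionalEquality using (_≡_; _≢_; refl; sym; trans; cong; subst; subst₂; cong₂; module ≡-Reasoning)
open import Function.Base using (_∘_; id)
open import Function.Bundles using (_⇔_; mk⇔; Equivalence)
import Function.Properties.Equivalence as ⇔

insertAt-length : ∀ {A : Set} (d : A) w → insertAt (length w) d w ≡ w ++ [ d ]
insertAt-length d w rewrite take-all (length w) w ≤-refl | drop-all (length w) w ≤-refl = refl

^^-snoc : ∀ {A : Set} (v : List A) n → v ^^ n ++ v ≡ v ^^ suc n
^^-snoc v zero = sym (++-identityʳ v)
^^-snoc v (suc n) = trans (++-assoc v (v ^^ n) v) (cong (v ++_) (^^-snoc v n))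

count : ∀ {k} → Fin k → Word k → ℕ
count c w = length (filter (c ≟_) w)

module _ {k : ℕ} where

  count-++ : ∀ (c : Fin k) u w → count c (u ++ w) ≡ count c u + count c w
  count-++ c u w = trans (cong length (filter-++ (c ≟_) u w)) (length-++ (filter (c ≟_) u))

  count-^^ : ∀ (c : Fin k) v n → count c (v ^^ n) ≡ n * count c v
  count-^^ c v zero = refl
  count-^^ c v (suc n) = trans (count-++ c v (v ^^ n)) (cong (count c v +_) (count-^^ c v n))

  count-replicate-self : ∀ (c : Fin k) n → count c (replicate n c) ≡ n
  count-replicate-self c zero = refl
  count-replicate-self c (suc n) =
    trans (cong length (filter-accept (c ≟_) refl)) (cong suc (count-replicate-self c n))

  count-replicate-other : ∀ {c d : Fin k} n → c ≢ d → count c (replicate n d) ≡ 0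
  count-replicate-other zero c≢d = refl
  count-replicate-other {c} (suc n) c≢d =
    trans (cong length (filter-reject (c ≟_) c≢d)) (count-replicate-other n c≢d)

  count-replicate-++-self : ∀ (c : Fin k) m w → count c (replicate m c ++ w) ≡ m + count c w
  count-replicate-++-self c m w = trans (count-++ c (replicate m c) w) (cong (_+ count c w) (count-replicate-self c m))

  count-replicate-++-other : ∀ {c d : Fin k} m w → c ≢ d → count c (replicate m d ++ w) ≡ count c w
  count-replicate-++-other {c} {d} m w c≢d =
    trans (count-++ c (replicate m d) w) (cong (_+ count c w) (count-replicate-other m c≢d))

  count-insertAt : ∀ (c : Fin k) i d w → count c (insertAt i d w) ≡ count c [ d ] + count c w
  count-insertAt c i d w = begin
    count c (take i w ++ [ d ] ++ drop i w)           ≡⟨ count-++ c (take i w) _ ⟩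
    count c (take i w) + count c ([ d ] ++ drop i w)   ≡⟨ cong (count c (take i w) +_) (count-++ c [ d ] (drop i w)) ⟩
    count c (take i w) + (count c [ d ] + count c (drop i w)) ≡⟨ x∙yz≈y∙xz (count c (take i w)) (count c [ d ]) (count c (drop i w)) ⟩
    count c [ d ] + (count c (take i w) + count c (drop i w)) ≡⟨ cong (count c [ d ] +_) (count-++ c (take i w) (drop i w)) ⟨
    count c [ d ] + count c (take i w ++ drop i w)      ≡⟨ cong (λ u → count c [ d ] + count c u) (take++drop≡id i w) ⟩
    count c [ d ] + count c w ∎
    where open ≡-Reasoning

  exponent-∣-count : ∀ (c : Fin k) v n → n ∣ count c (v ^^ n)
  exponent-∣-count c v n = divides (count c v) (trans (count-^^ c v n) (*-comm n (count c v)))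

  primitive-if-coprime-counts : ∀ {a b : Fin k} w → Coprime (count a w) (count b w) → Primitive w
  primitive-if-coprime-counts {a} {b} w coprime = nonempty , not-power
    where
    nonempty : ¬ w ≡ []
    nonempty refl with () ← 0-coprimeTo-m⇒m≡1 coprime
    not-power : ¬ (∃[ v ] ∃[ n ] (2 ≤ n × w ≡ v ^^ n))
    not-power (v , n , 2≤n , w≡vⁿ) = 2≰1 (subst (2 ≤_) (coprime (divides-count a , divides-count b)) 2≤n)
      where
      divides-count : ∀ c → n ∣ count c w
      divides-count c = subst (λ u → n ∣ count c u) (sym w≡vⁿ) (exponent-∣-count c v n)
      2≰1 : ¬ 2 ≤ 1
      2≰1 (s≤s ())

  insRobust-if-coprime-counts : ∀ {a b : Fin k} {x y} w → a ≢ b →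
    Coprime x y → Coprime (suc x) y → Coprime x (suc y) →
    count a w ≡ x → count b w ≡ y → QI k w
  insRobust-if-coprime-counts {a} {b} w a≢b x⊥y sx⊥y x⊥sy refl refl =
    primitive-if-coprime-counts w x⊥y ,
    λ i _ d → primitive-if-coprime-counts (insertAt i d w)
      (subst₂ Coprime (sym (count-insertAt a i d w)) (sym (count-insertAt b i d w)) (coprime-after-adding d))
    where
    coprime-after-adding : ∀ d → Coprime (count a [ d ] + count a w) (count b [ d ] + count b w)
    coprime-after-adding d with d ≟ a | d ≟ b
    ... | yes refl | _ rewrite count-replicate-self a 1 | count-replicate-other 1 (a≢b ∘ sym) = sx⊥y
    ... | no d≢a | yes refl rewrite count-replicate-self b 1 | count-replicate-other 1 a≢b = x⊥sy
    ... | no d≢a | no d≢b rewrite count-replicate-other 1 (d≢a ∘ sym) | count-replicate-other 1 (d≢b ∘ sym) = x⊥y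

  ¬insRobust-if-snoc-power : ∀ w (d : Fin k) v n → 2 ≤ n → w ++ [ d ] ≡ v ^^ n → ¬ QI k w
  ¬insRobust-if-snoc-power w d v n 2≤n w∷ʳd≡vⁿ (_ , robust) =
    proj₂ (robust (length w) ≤-refl d) (v , n , 2≤n , trans (insertAt-length d w) w∷ʳd≡vⁿ)

suc-coprime : ∀ n → Coprime (suc n) n
suc-coprime n = subst (λ m → Coprime m n) (+-comm n 1) (coprime-+ (1-coprimeTo n))

coprime-+suc : ∀ n → Coprime n (n + suc n)
coprime-+suc n = coprime-sym (coprime-+ (suc-coprime n))

suc-coprime-+suc : ∀ n → Coprime (suc n) (n + suc n)
suc-coprime-+suc n =
  coprime-sym (subst (λ m → Coprime m (suc n)) (+-comm (suc n) n) (coprime-+ (coprime-sym (suc-coprime n))))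

coprime-suc-+suc : ∀ {n} → Coprime 2 n → Coprime n (suc (n + suc n))
coprime-suc-+suc {n} 2⊥n = coprime-sym (subst (λ m → Coprime m n) n+[n+2]≡1+[n+1+n] (coprime-+ (coprime-+ 2⊥n)))
  where
  n+[n+2]≡1+[n+1+n] : n + (n + 2) ≡ suc (n + suc n)
  n+[n+2]≡1+[n+1+n] = trans (cong (n +_) (+-comm n 2)) (+-suc n (suc n))

odd-coprime-2 : ∀ t → Coprime (1 + 2 * t) 2
odd-coprime-2 zero = 1-coprimeTo 2
odd-coprime-2 (suc t) = subst (λ m → Coprime m 2) (2+[1+2t]≡1+2[1+t] t) (coprime-+ (odd-coprime-2 t))
  where
  2+[1+2t]≡1+2[1+t] : ∀ t → 2 + (1 + 2 * t) ≡ 1 + 2 * suc t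
  2+[1+2t]≡1+2[1+t] = solve-∀

module _ {k} (M : DFA k) where
  open DFA M

  accepts-++-if-same-state : ∀ u u' → foldl δ q₀ u ≡ foldl δ q₀ u' →
    ∀ s → Accepts M (u ++ s) ⇔ Accepts M (u' ++ s)
  accepts-++-if-same-state u u' same s = mk⇔ (subst id accepts≡) (subst id (sym accepts≡))
    where
    accepts≡ : Accepts M (u ++ s) ≡ Accepts M (u' ++ s)
    accepts≡ = cong (λ q → T (final q)) (begin
      foldl δ q₀ (u ++ s)              ≡⟨ foldl-++ δ q₀ u s ⟩
      foldl δ (foldl δ q₀ u) s          ≡⟨ cong (λ q → foldl δ q s) same ⟩
      foldl δ (foldl δ q₀ u') s         ≡⟨ foldl-++ δ q₀ u' s ⟨
      foldl δ q₀ (u' ++ s)             ∎)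
      where open ≡-Reasoning

regular⇒prefixes-collide : ∀ {k} {L : Word k → Set} → Regular L → (u : ℕ → Word k) →
  ∃[ i ] ∃[ j ] (i < j × ∀ s → L (u i ++ s) ⇔ L (u j ++ s))
regular⇒prefixes-collide (M , L⇔M) u
  with i , j , i<j , same ← pigeonhole (n<1+n (DFA.nStates M)) (λ i → foldl (DFA.δ M) (DFA.q₀ M) (u (toℕ i)))
  = toℕ i , toℕ j , i<j ,
    λ s → ⇔.trans (L⇔M _) (⇔.trans (accepts-++-if-same-state M (u (toℕ i)) (u (toℕ j)) same s) (⇔.sym (L⇔M _)))

module SeparatingSuffix {k} {a b : Fin k} (a≢b : a ≢ b) (P n : ℕ) where
  -- With D = n + 1, the counts of a ^ (P + D) s are D + (D + 1) α and (D + 1) (β + 1) − 1,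
  -- which α = 2P + 1 and β = 2α + 1 turn into x odd and 2x + 1.
  α β q x : ℕ
  α = P + suc P
  β = suc (2 * α)
  q = suc n + (2 + n) * P
  x = 1 + 2 * q

  b≢a : b ≢ a
  b≢a = a≢b ∘ sym

  r t v s : Word k
  r = replicate (suc P) a ++ replicate β b
  t = replicate P a ++ r
  v = t ++ [ b ]
  s = r ++ [ b ] ++ v ^^ n ++ t

  unfold : replicate P a ++ s ≡ v ^^ suc n ++ t
  unfold = begin
    replicate P a ++ r ++ [ b ] ++ v ^^ n ++ t   ≡⟨ ++-assoc (replicate P a) r ([ b ] ++ v ^^ n ++ t) ⟨
    t ++ [ b ] ++ v ^^ n ++ t                   ≡⟨ ++-assoc t [ b ] (v ^^ n ++ t) ⟨
    v ++ v ^^ n ++ t                             ≡⟨ ++-assoc v (v ^^ n) t ⟨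
    v ^^ suc n ++ t                              ∎
    where open ≡-Reasoning

  snoc-power : (replicate P a ++ s) ++ [ b ] ≡ v ^^ (2 + n)
  snoc-power = begin
    (replicate P a ++ s) ++ [ b ]  ≡⟨ cong (_++ [ b ]) unfold ⟩
    (v ^^ suc n ++ t) ++ [ b ]     ≡⟨ ++-assoc (v ^^ suc n) t [ b ] ⟩
    v ^^ suc n ++ v                ≡⟨ ^^-snoc v (suc n) ⟩
    v ^^ (2 + n)                   ∎
    where open ≡-Reasoning

  counts-via-snoc : ∀ c → count c (replicate P a ++ s) + count c [ b ] ≡ (2 + n) * count c v
  counts-via-snoc c = trans (sym (count-++ c (replicate P a ++ s) [ b ])) (trans (cong (count c) snoc-power) (count-^^ c v (2 + n)))

  count-a-v : count a v ≡ α
  count-a-v = begin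
    count a (t ++ [ b ])                     ≡⟨ count-++ a t [ b ] ⟩
    count a t + count a [ b ]                ≡⟨ cong₂ _+_ (count-replicate-++-self a P r) (count-replicate-other 1 a≢b) ⟩
    P + count a r + 0                        ≡⟨ +-identityʳ _ ⟩
    P + count a r                            ≡⟨ cong (P +_) (count-replicate-++-self a (suc P) (replicate β b)) ⟩
    P + (suc P + count a (replicate β b))    ≡⟨ cong (λ c → P + (suc P + c)) (count-replicate-other β a≢b) ⟩
    P + (suc P + 0)                          ≡⟨ cong (P +_) (+-identityʳ (suc P)) ⟩
    α                                        ∎
    where open ≡-Reasoning

  count-b-v : count b v ≡ β + 1
  count-b-v = begin
    count b (t ++ [ b ])                     ≡⟨ count-++ b t [ b ] ⟩
    count b t + count b [ b ]                ≡⟨ cong₂ _+_ (count-replicate-++-other P r b≢a) (count-replicate-self b 1) ⟩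
    count b r + 1                            ≡⟨ cong (_+ 1) (count-replicate-++-other (suc P) (replicate β b) b≢a) ⟩
    count b (replicate β b) + 1              ≡⟨ cong (_+ 1) (count-replicate-self b β) ⟩
    β + 1                                    ∎
    where open ≡-Reasoning

  count-a : count a (replicate (P + suc n) a ++ s) ≡ x
  count-a = begin
    count a (replicate (P + suc n) a ++ s)                   ≡⟨ count-replicate-++-self a (P + suc n) s ⟩
    P + suc n + count a s                                     ≡⟨ shuffle P (suc n) (count a s) ⟩
    suc n + (P + count a s + 0)                               ≡⟨ cong (suc n +_) (cong₂ _+_ (count-replicate-++-self a P s) (count-replicate-other 1 a≢b)) ⟨
    suc n + (count a (replicate P a ++ s) + count a [ b ])    ≡⟨ cong (suc n +_) (counts-via-snoc a) ⟩
    suc n + (2 + n) * count a v                              ≡⟨ cong (λ c → suc n + (2 + n) * c) count-a-v ⟩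
    suc n + (2 + n) * α                                      ≡⟨ odd P n ⟩
    x                                                        ∎
    where
    open ≡-Reasoning
    shuffle : ∀ p m c → p + m + c ≡ m + (p + c + 0)
    shuffle = solve-∀
    odd : ∀ p m → suc m + (2 + m) * (p + suc p) ≡ 1 + 2 * (suc m + (2 + m) * p)
    odd = solve-∀

  count-b : count b (replicate (P + suc n) a ++ s) ≡ x + suc x
  count-b = trans (count-replicate-++-other (P + suc n) s b≢a) (+-cancelʳ-≡ 1 (count b s) (x + suc x) (begin
    count b s + 1                                          ≡⟨ cong₂ _+_ (count-replicate-++-other P s b≢a) (count-replicate-self b 1) ⟨
    count b (replicate P a ++ s) + count b [ b ]           ≡⟨ counts-via-snoc b ⟩
    (2 + n) * count b v                                    ≡⟨ cong ((2 + n) *_) count-b-v ⟩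
    (2 + n) * (β + 1)                                      ≡⟨ balance P n ⟩
    x + suc x + 1                                          ∎))
    where
    open ≡-Reasoning
    balance : ∀ p m → (2 + m) * (suc (2 * (p + suc p)) + 1)
                      ≡ 1 + 2 * (suc m + (2 + m) * p) + suc (1 + 2 * (suc m + (2 + m) * p)) + 1
    balance = solve-∀

  separating-suffix : ∃[ s ] (¬ QI k (replicate P a ++ s) × QI k (replicate (P + suc n) a ++ s))
  separating-suffix =
    s ,
    ¬insRobust-if-snoc-power (replicate P a ++ s) b v (2 + n) (s≤s (s≤s z≤n)) snoc-power ,
    insRobust-if-coprime-counts (replicate (P + suc n) a ++ s) a≢b
      (coprime-+suc x) (suc-coprime-+suc x) (coprime-suc-+suc (coprime-sym (odd-coprime-2 q))) count-a count-b

open SeparatingSuffix using (separating-suffix)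

theorem20 : ∀ (k : ℕ) → 2 ≤ k → ¬ Regular (QI k)
theorem20 (suc (suc k)) (s≤s (s≤s z≤n)) regular
  with P , Q , P<Q , prefixes-agree ← regular⇒prefixes-collide regular (λ m → replicate m fzero)
  with n , P+1+n≡Q ← m≤n⇒∃[o]m+o≡n P<Q
  with s , ¬QI-P , QI-Q ← separating-suffix {b = fsuc fzero} (λ ()) P n
  = ¬QI-P (Equivalence.from (prefixes-agree s) (subst (λ m → QI _ (replicate m fzero ++ s)) P+sn≡Q QI-Q))
  where
  P+sn≡Q : P + suc n ≡ Q
  P+sn≡Q = trans (+-suc P n) P+1+n≡Q
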